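{- Let $p$ be an odd prime. If $\overline{2}$ generates the group $(\mathbb{Z}/p\mathbb{Z})^*$, then $\ell_{\mathbb{Z}/p\mathbb{Z}}\geq 3\cdot\frac{p-1}{2}$.
   Context: For a commutative unital ring $A$ and $a_1,\ldots,a_n\in A$ set $M_n(a_1,\ldots,a_n)=\begin{pmatrix} a_n & -1_A\\ 1_A & 0_A\end{pmatrix}\cdots\begin{pmatrix} a_1 & -1_A\\ 1_A & 0_A\end{pmatrix}$. An $n$-tuple is a $\lambda$-quiddity if $M_n(a_1,\ldots,a_n)=\pm \mathrm{Id}$. For tuples, $(a_1,\ldots,a_n)\oplus(b_1,\ldots,b_m)=(a_1+b_m,a_2,\ldots,a_{n-1},a_n+b_1,b_2,\ldots,b_{m-1})$. Write $(a_1,\ldots,a_n)\sim(b_1,\ldots,b_n)$ if $(b_1,\ldots,b_n)$ is obtained from $(a_1,\ldots,a_n)$ or from $(a_n,\ldots,a_1)$ by a cyclic permutation. A $\lambda$-quiddity $(c_1,\ldots,c_n)$ with $n\geq 3$ is reducible if there exist a $\lambda$-quiddity $(b_1,\ldots,b_l)$ and a tuple $(a_1,\ldots,a_m)$ with $l,m\geq 3$ and $(c_1,\ldots,c_n)\sim(a_1,\ldots,a_m)\oplus(b_1,\ldots,b_l)$; otherwise irreducible. For finite $A$ there are finitely many irreducible $\lambda$-quiddities, and $\ell_A$ denotes their maximal size. -}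

module Defs where

open import Data.Nat as ℕ using (ℕ; zero; suc)
open import Data.Integer as ℤ using (ℤ; +_; _+_; _-_; _*_; -_)
open import Data.Integer.Divisibility using (_∣_)
open import Data.List as List using (List; []; _∷_; length; foldl; [_])
open import Data.List.Relation.Binary.Pointwise using (Pointwise)
open import Data.Vec as Vec using (Vec; _∷_)
open import Data.Product using (Σ; ∃; _×_; _,_)
open import Data.Sum using (_⊎_)
open import Relation.Nullary using (¬_)

-- The ring ℤ/pℤ is represented by integer representatives; two
-- representatives denote the same element iff they are congruent mod p.
_≡[_]_ : ℤ → ℕ → ℤ → Set
x ≡[ p ] y = (+ p) ∣ (x - y)

record Mat : Set where
  constructor mat
  field
    m11 m12 m21 m22 : ℤ

_⊗_ : Mat → Mat → Mat
mat a b c d ⊗ mat e f g h =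
  mat (a * e + b * g) (a * f + b * h) (c * e + d * g) (c * f + d * h)

Id : Mat
Id = mat (+ 1) (+ 0) (+ 0) (+ 1)

negId : Mat
negId = mat (- + 1) (+ 0) (+ 0) (- + 1)

step : ℤ → Mat
step a = mat a (- + 1) (+ 1) (+ 0)

M : List ℤ → Mat
M = foldl (λ acc a → step a ⊗ acc) Id

_≈M[_]_ : Mat → ℕ → Mat → Set
mat a b c d ≈M[ p ] mat e f g h =
  (a ≡[ p ] e) × (b ≡[ p ] f) × (c ≡[ p ] g) × (d ≡[ p ] h)

IsQuiddity : ℕ → List ℤ → Set
IsQuiddity p as = (M as ≈M[ p ] Id) ⊎ (M as ≈M[ p ] negId)

-- (a_1..a_n) ⊕ (b_1..b_l) = (a_1+b_l, a_2..a_{n-1}, a_n+b_1, b_2..b_{l-1}),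
-- defined for n = 2 + m, l = 2 + k.
_⊕_ : ∀ {m k} → Vec ℤ (suc (suc m)) → Vec ℤ (suc (suc k)) → List ℤ
(x ∷ xs) ⊕ (y ∷ ys) =
  (x + Vec.last ys) ∷ (Vec.toList (Vec.init xs) List.++ ((Vec.last xs + y) ∷ Vec.toList (Vec.init ys)))

-- entrywise equality of tuples over ℤ/pℤ (forces equal lengths)
_≈[_]_ : List ℤ → ℕ → List ℤ → Set
as ≈[ p ] bs = Pointwise (λ x y → x ≡[ p ] y) as bs

rot : List ℤ → List ℤ
rot [] = []
rot (x ∷ xs) = xs List.++ [ x ]

rotN : ℕ → List ℤ → List ℤ
rotN zero xs = xs
rotN (suc k) xs = rot (rotN k xs)

_∼[_]_ : List ℤ → ℕ → List ℤ → Set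
as ∼[ p ] bs = ∃ λ k → (bs ≈[ p ] rotN k as) ⊎ (bs ≈[ p ] rotN k (List.reverse as))

Reducible : ℕ → List ℤ → Set
Reducible p c =
  Σ ℕ λ m → Σ ℕ λ k →
  Σ (Vec ℤ (3 ℕ.+ m)) λ a → Σ (Vec ℤ (3 ℕ.+ k)) λ b →
    IsQuiddity p (Vec.toList b) × (c ∼[ p ] (a ⊕ b))

IrreducibleQuiddity : ℕ → List ℤ → Set
IrreducibleQuiddity p c = (3 ℕ.≤ length c) × IsQuiddity p c × ¬ Reducible p c

TwoGenerates : ℕ → Set
TwoGenerates p = ∀ (x : ℤ) → ¬ ((+ p) ∣ x) → ∃ λ (k : ℕ) → ((+ 2) ℤ.^ k) ≡[ p ] x

-- Write p = 2k + 1 and ½ = k + 1, the inverse of 2 modulo p; the witness is c = (2, ½, ½)^k, of length 3k.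
-- Modulo p, M(2, ½, ½) is upper triangular with diagonal (−2, −½), so M(c) has diagonal ((−2)^k, (−½)^k)
-- and off-diagonal entry ½((−½)^k − (−2)^k). As 2 generates (ℤ/pℤ)^*, it has order 2k, hence 2^k ≡ −1 and
-- M(c) ≡ ±Id.
-- If c ∼ a ⊕ b with b a λ-quiddity of size l, then M(b) ≡ ±Id forces the continuant (the (1,1) entry of M)
-- of b₂ … b_{l−1} to be ±1, and this block is a suffix of a rotation of c or of its reverse, leaving at
-- least 3 entries in front. Such a suffix is a nonempty tail of a rotation of (2, ½, ½) followed by
-- j ≤ k − 2 full periods; its continuant is ±(−2)^{j+1}, ±(−½)^{j+1}, 0 or ½²(−½)^j − (−2)^j. The first
-- two are not ±1 because 2 has order 2k, and the last being ±1 would make 2 a square modulo p, which a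
-- generator of (ℤ/pℤ)^* is not.

module Submission where

open import Data.Empty using (⊥-elim)
open import Data.Fin as Fin using (Fin; toℕ)
import Data.Fin.Properties as Finₚ
open import Data.Integer as ℤ using (ℤ; +_; _+_; _-_; _*_; -_; _^_; ∣_∣; 0ℤ; 1ℤ; -1ℤ)
import Data.Integer.Properties as ℤₚ
import Data.Integer.Divisibility.Signed as Signed
open import Data.Integer.Tactic.RingSolver using (solve-∀)
import Data.Nat.Tactic.RingSolver as ℕSolver
open import Function using (_∘_)
open import Data.List as List using (List; []; _∷_; _++_; [_]; length; reverse)
import Data.List.Properties as Listₚ
open import Data.List.Relation.Binary.Pointwise using (Pointwise; []; _∷_; Pointwise-length)
open import Data.Nat as ℕ using (ℕ; zero; suc; _<_; _≤_; z≤n; s≤s)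
open import Data.Nat.DivMod using (_%_; _/_; _mod_; m≡m%n+[m/n]*n; m%n<n; m*n/n≡m)
open import Data.Nat.Divisibility as ℕ∣ using (>⇒∤)
open import Data.Nat.Primality using (Prime; euclidsLemma; ¬prime[1]; prime⇒irreducible)
import Data.Nat.Properties as ℕₚ
open import Data.Product as Product using (Σ; ∃; ∃₂; _×_; _,_; proj₁; proj₂)
open import Data.Sum as Sum using (_⊎_; inj₁; inj₂; [_,_]′)
open import Data.Vec as Vec using (Vec)
import Data.Vec.Properties as Vecₚ
open import Relation.Binary.PropositionalEquality
  using (_≡_; _≢_; refl; sym; trans; cong; cong₂; subst; module ≡-Reasoning)
open import Level using (0ℓ)
open import Relation.Binary.Bundles using (Setoid)
import Relation.Binary.Reasoning.Setoid as SetoidReasoning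
open import Relation.Nullary using (¬_; Dec; yes; no)
open import Relation.Nullary.Decidable using (map′)

open import Defs

variable
  A : Set
  x y z : A
  u v : ℤ
  j : ℕ

-- Repeated words

repeat : ℕ → List A → List A
repeat zero    xs = []
repeat (suc n) xs = xs ++ repeat n xs

length-repeat : ∀ n (xs : List A) → length (repeat n xs) ≡ n ℕ.* length xs
length-repeat zero    xs = refl
length-repeat (suc n) xs = trans (Listₚ.length-++ xs) (cong (length xs ℕ.+_) (length-repeat n xs))

repeat-++-comm : ∀ n (xs : List A) → repeat n xs ++ xs ≡ xs ++ repeat n xs
repeat-++-comm zero    xs = sym (Listₚ.++-identityʳ xs)
repeat-++-comm (suc n) xs = trans (Listₚ.++-assoc xs (repeat n xs) xs) (cong (xs ++_) (repeat-++-comm n xs))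

reverse-repeat : ∀ n (xs : List A) → reverse (repeat n xs) ≡ repeat n (reverse xs)
reverse-repeat zero    xs = refl
reverse-repeat (suc n) xs = begin
  reverse (xs ++ repeat n xs)           ≡⟨ Listₚ.reverse-++ xs (repeat n xs) ⟩
  reverse (repeat n xs) ++ reverse xs   ≡⟨ cong (_++ reverse xs) (reverse-repeat n xs) ⟩
  repeat n (reverse xs) ++ reverse xs   ≡⟨ repeat-++-comm n (reverse xs) ⟩
  repeat (suc n) (reverse xs)           ∎
  where open ≡-Reasoning

repeat-∷-++ : ∀ n x (xs : List A) → repeat n (x ∷ xs) ++ [ x ] ≡ x ∷ repeat n (xs ++ [ x ])
repeat-∷-++ zero    x xs = refl
repeat-∷-++ (suc n) x xs = cong (x ∷_) (begin
  (xs ++ repeat n (x ∷ xs)) ++ [ x ]        ≡⟨ Listₚ.++-assoc xs (repeat n (x ∷ xs)) [ x ] ⟩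
  xs ++ (repeat n (x ∷ xs) ++ [ x ])        ≡⟨ cong (xs ++_) (repeat-∷-++ n x xs) ⟩
  xs ++ x ∷ repeat n (xs ++ [ x ])          ≡⟨ Listₚ.++-assoc xs [ x ] (repeat n (xs ++ [ x ])) ⟨
  (xs ++ [ x ]) ++ repeat n (xs ++ [ x ])   ∎)
  where open ≡-Reasoning

rot-repeat : ∀ n (xs : List ℤ) → rot (repeat n xs) ≡ repeat n (rot xs)
rot-repeat zero    xs       = refl
rot-repeat (suc n) []       = rot-repeat n []
rot-repeat (suc n) (x ∷ xs) = Listₚ.∷-injectiveʳ (repeat-∷-++ (suc n) x xs)

rotN-repeat : ∀ r n (xs : List ℤ) → rotN r (repeat n xs) ≡ repeat n (rotN r xs)
rotN-repeat zero    n xs = refl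
rotN-repeat (suc r) n xs = trans (cong rot (rotN-repeat r n xs)) (rot-repeat n (rotN r xs))

data RepeatSuffix {A : Set} : List A → ℕ → List A → Set where
  whole  : RepeatSuffix (x ∷ y ∷ z ∷ []) j (repeat (suc j) (x ∷ y ∷ z ∷ []))
  from-y : RepeatSuffix (x ∷ y ∷ z ∷ []) j (y ∷ z ∷ repeat j (x ∷ y ∷ z ∷ []))
  from-z : RepeatSuffix (x ∷ y ∷ z ∷ []) j (z ∷ repeat j (x ∷ y ∷ z ∷ []))

∷³-injectiveʳ : ∀ {x y z x′ y′ z′ : A} {xs ys : List A} →
                List._∷_ x (y ∷ z ∷ xs) ≡ x′ ∷ y′ ∷ z′ ∷ ys → xs ≡ ys
∷³-injectiveʳ refl = refl

suffix-of-repeat : ∀ n (L₁ : List A) {L₂} → repeat n (x ∷ y ∷ z ∷ []) ≡ L₁ ++ L₂ →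
                   0 < length L₂ → ∃ λ j → j < n × RepeatSuffix (x ∷ y ∷ z ∷ []) j L₂
suffix-of-repeat zero    []                   refl ()
suffix-of-repeat (suc n) []                   refl _ = n , ℕₚ.n<1+n n , whole
suffix-of-repeat (suc n) (_ ∷ [])             refl _ = n , ℕₚ.n<1+n n , from-y
suffix-of-repeat (suc n) (_ ∷ _ ∷ [])         refl _ = n , ℕₚ.n<1+n n , from-z
suffix-of-repeat (suc n) (_ ∷ _ ∷ _ ∷ L₁) eq nonempty
  with j , j<n , s ← suffix-of-repeat n L₁ (∷³-injectiveʳ eq) nonempty
  = j , ℕₚ.m<n⇒m<1+n j<n , s

proper-suffix-of-repeat : ∀ {B : List A} n {L₁ L₂} → length B ≡ 3 → repeat n B ≡ L₁ ++ L₂ →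
                          3 ≤ length L₁ → 0 < length L₂ → ∃ λ j → suc j < n × RepeatSuffix B j L₂
proper-suffix-of-repeat {B = _ ∷ _ ∷ _ ∷ []} zero {_ ∷ _ ∷ _ ∷ _} refl () _ _
proper-suffix-of-repeat {B = _ ∷ _ ∷ _ ∷ []} (suc n) {_ ∷ _ ∷ _ ∷ L₁}
                        refl eq (s≤s (s≤s (s≤s _))) nonempty
  with j , j<n , s ← suffix-of-repeat n L₁ (∷³-injectiveʳ eq) nonempty
  = j , s≤s j<n , s

Pointwise-++⁻ : ∀ {R : A → A → Set} xs {ys L} → Pointwise R (xs ++ ys) L →
                ∃₂ λ L₁ L₂ → L ≡ L₁ ++ L₂ × Pointwise R xs L₁ × Pointwise R ys L₂
Pointwise-++⁻ []       xs++ys≈L = [] , _ , refl , [] , xs++ys≈L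
Pointwise-++⁻ (x ∷ xs) (x≈l ∷ xs++ys≈L)
  with L₁ , L₂ , refl , xs≈L₁ , ys≈L₂ ← Pointwise-++⁻ xs xs++ys≈L
  = _ ∷ L₁ , L₂ , refl , x≈l ∷ xs≈L₁ , ys≈L₂

toList-init-last : ∀ {n} (xs : Vec A (suc n)) →
                   Vec.toList xs ≡ Vec.toList (Vec.init xs) ++ [ Vec.last xs ]
toList-init-last xs =
  trans (cong Vec.toList (proj₂ (proj₂ (Vec.initLast xs)))) (Vecₚ.toList-∷ʳ (Vec.last xs) (Vec.init xs))

-- The matrices M

mat-cong : ∀ {a b c d a′ b′ c′ d′} → a ≡ a′ → b ≡ b′ → c ≡ c′ → d ≡ d′ →
           mat a b c d ≡ mat a′ b′ c′ d′
mat-cong refl refl refl refl = refl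

⊗-assoc : ∀ A B C → (A ⊗ B) ⊗ C ≡ A ⊗ (B ⊗ C)
⊗-assoc (mat a b c d) (mat e f g h) (mat i j k l) =
  mat-cong (entry a b e f g h i k) (entry a b e f g h j l) (entry c d e f g h i k) (entry c d e f g h j l)
  where
  entry : ∀ a b e f g h i k →
          (a * e + b * g) * i + (a * f + b * h) * k ≡ a * (e * i + f * k) + b * (g * i + h * k)
  entry = solve-∀

⊗-identityʳ : ∀ A → A ⊗ Id ≡ A
⊗-identityʳ (mat a b c d) = mat-cong (left a b) (right a b) (left c d) (right c d)
  where
  left : ∀ a b → a * 1ℤ + b * 0ℤ ≡ a
  left = solve-∀
  right : ∀ a b → a * 0ℤ + b * 1ℤ ≡ b
  right = solve-∀

⊗-identityˡ : ∀ A → Id ⊗ A ≡ A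
⊗-identityˡ (mat a b c d) = mat-cong (top a c) (top b d) (bottom a c) (bottom b d)
  where
  top : ∀ a c → 1ℤ * a + 0ℤ * c ≡ a
  top = solve-∀
  bottom : ∀ a c → 0ℤ * a + 1ℤ * c ≡ c
  bottom = solve-∀

foldl-step : ∀ xs A → List.foldl (λ acc a → step a ⊗ acc) A xs ≡ M xs ⊗ A
foldl-step []       A = sym (⊗-identityˡ A)
foldl-step (x ∷ xs) A = begin
  List.foldl _ (step x ⊗ A) xs   ≡⟨ foldl-step xs (step x ⊗ A) ⟩
  M xs ⊗ (step x ⊗ A)            ≡⟨ cong (λ S → M xs ⊗ (S ⊗ A)) (⊗-identityʳ (step x)) ⟨
  M xs ⊗ ((step x ⊗ Id) ⊗ A)     ≡⟨ ⊗-assoc (M xs) (step x ⊗ Id) A ⟨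
  (M xs ⊗ (step x ⊗ Id)) ⊗ A     ≡⟨ cong (_⊗ A) (foldl-step xs (step x ⊗ Id)) ⟨
  M (x ∷ xs) ⊗ A                 ∎
  where open ≡-Reasoning

M-++ : ∀ xs ys → M (xs ++ ys) ≡ M ys ⊗ M xs
M-++ xs ys = trans (Listₚ.foldl-++ _ Id xs ys) (foldl-step ys (M xs))

M-[x] : ∀ x → M [ x ] ≡ step x
M-[x] x = ⊗-identityʳ (step x)

M-∷ : ∀ x xs → M (x ∷ xs) ≡ M xs ⊗ step x
M-∷ x xs = trans (M-++ [ x ] xs) (cong (M xs ⊗_) (M-[x] x))

M-[x,y] : ∀ x y → M (x ∷ y ∷ []) ≡ mat (y * x - 1ℤ) (- y) x -1ℤ
M-[x,y] x y = trans (cong (step y ⊗_) (M-[x] x)) (mat-cong (e₁₁ x y) (e₁₂ y) (e₂₁ x) refl)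
  where
  e₁₁ : ∀ x y → y * x + -1ℤ * 1ℤ ≡ y * x - 1ℤ
  e₁₁ = solve-∀
  e₁₂ : ∀ y → y * -1ℤ + -1ℤ * 0ℤ ≡ - y
  e₁₂ = solve-∀
  e₂₁ : ∀ x → 1ℤ * x + 0ℤ * 1ℤ ≡ x
  e₂₁ = solve-∀

M-[x,y,z] : ∀ x y z → M (x ∷ y ∷ z ∷ []) ≡ mat (z * x * y - z - x) (1ℤ - z * y) (x * y - 1ℤ) (- y)
M-[x,y,z] x y z =
  trans (cong (step z ⊗_) (M-[x,y] x y)) (mat-cong (e₁₁ x y z) (e₁₂ y z) (e₂₁ x y) (e₂₂ y))
  where
  e₁₁ : ∀ x y z → z * (y * x - 1ℤ) + -1ℤ * x ≡ z * x * y - z - x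
  e₁₁ = solve-∀
  e₁₂ : ∀ y z → z * - y + -1ℤ * -1ℤ ≡ 1ℤ - z * y
  e₁₂ = solve-∀
  e₂₁ : ∀ x y → 1ℤ * (y * x - 1ℤ) + 0ℤ * x ≡ x * y - 1ℤ
  e₂₁ = solve-∀
  e₂₂ : ∀ y → 1ℤ * - y + 0ℤ * -1ℤ ≡ - y
  e₂₂ = solve-∀

m22-M-∷-∷ʳ : ∀ y xs x → Mat.m22 (M (y ∷ xs List.∷ʳ x)) ≡ - Mat.m11 (M xs)
m22-M-∷-∷ʳ y xs x = begin
  Mat.m22 (M ((y ∷ xs) ++ [ x ]))      ≡⟨ cong Mat.m22 (M-++ (y ∷ xs) [ x ]) ⟩
  Mat.m22 (M [ x ] ⊗ M (y ∷ xs))       ≡⟨ cong₂ (λ X Y → Mat.m22 (X ⊗ Y)) (M-[x] x) (M-∷ y xs) ⟩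
  Mat.m22 (step x ⊗ (M xs ⊗ step y))
    ≡⟨ entry (Mat.m11 (M xs)) (Mat.m12 (M xs)) (Mat.m21 (M xs)) (Mat.m22 (M xs)) ⟩
  - Mat.m11 (M xs)                     ∎
  where
  open ≡-Reasoning
  entry : ∀ a b c d → 1ℤ * (a * -1ℤ + b * 0ℤ) + 0ℤ * (c * -1ℤ + d * 0ℤ) ≡ - a
  entry = solve-∀

-- Integers and congruences modulo p

^-distribʳ-* : ∀ x y n → (x * y) ^ n ≡ x ^ n * y ^ n
^-distribʳ-* x y zero    = refl
^-distribʳ-* x y (suc n) = trans (cong (x * y *_) (^-distribʳ-* x y n)) (swap x y (x ^ n) (y ^ n))
  where
  swap : ∀ x y u v → x * y * (u * v) ≡ x * u * (y * v)
  swap = solve-∀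

-‿^ : ∀ x n → (- x) ^ n ≡ x ^ n ⊎ (- x) ^ n ≡ - x ^ n
-‿^ x zero = inj₁ refl
-‿^ x (suc n) with -‿^ x n
... | inj₁ eq = inj₂ (trans (cong (- x *_) eq) (odd x (x ^ n)))
  where
  odd : ∀ x u → - x * u ≡ - (x * u)
  odd = solve-∀
... | inj₂ eq = inj₁ (trans (cong (- x *_) eq) (even x (x ^ n)))
  where
  even : ∀ x u → - x * - u ≡ x * u
  even = solve-∀

2ℤ : ℤ
2ℤ = + 2

pos-^ : ∀ a n → + (a ℕ.^ n) ≡ (+ a) ^ n
pos-^ a zero    = refl
pos-^ a (suc n) = trans (ℤₚ.pos-* a (a ℕ.^ n)) (cong (+ a *_) (pos-^ a n))

<∧∣⇒≡0 : ∀ {d n} → d < n → n ℕ∣.∣ d → d ≡ 0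
<∧∣⇒≡0 {zero}  _   _   = refl
<∧∣⇒≡0 {suc d} d<n n∣d = ⊥-elim (>⇒∤ d<n n∣d)

n+n≡2*n : ∀ n → n ℕ.+ n ≡ 2 ℕ.* n
n+n≡2*n n = cong (n ℕ.+_) (sym (ℕₚ.+-identityʳ n))

module Modulo (p : ℕ) where

  infix 4 _≈_ _≉_ _≈±1

  -- A record rather than a synonym of x ≡[ p ] y, so that x and y can be inferred from a proof.
  record _≈_ (x y : ℤ) : Set where
    constructor wrap
    field unwrap : x ≡[ p ] y
  open _≈_ public

  _≉_ : ℤ → ℤ → Set
  x ≉ y = ¬ x ≈ y

  private
    ≈⇒∣ : x ≈ y → + p Signed.∣ x - y
    ≈⇒∣ (wrap p∣x-y) = Signed.∣ᵤ⇒∣ p∣x-y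

    ∣⇒≈ : + p Signed.∣ x - y → x ≈ y
    ∣⇒≈ p∣x-y = wrap (Signed.∣⇒∣ᵤ p∣x-y)

    ∣-resp : ∀ {a b} → a ≡ b → + p Signed.∣ a → + p Signed.∣ b
    ∣-resp = subst (+ p Signed.∣_)

  ≈-by-multiple : ∀ q → x - y ≡ q * + p → x ≈ y
  ≈-by-multiple q eq = ∣⇒≈ (Signed.divides q eq)

  ≡⇒≈ : x ≡ y → x ≈ y
  ≡⇒≈ {x} refl = ≈-by-multiple 0ℤ (ℤₚ.+-inverseʳ x)

  ≈-refl : x ≈ x
  ≈-refl = ≡⇒≈ refl

  ≈-sym : x ≈ y → y ≈ x
  ≈-sym {x} {y} x≈y = ∣⇒≈ (∣-resp (identity x y) (Signed.∣m⇒∣-m (≈⇒∣ x≈y)))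
    where
    identity : ∀ x y → - (x - y) ≡ y - x
    identity = solve-∀

  ≈-trans : x ≈ y → y ≈ u → x ≈ u
  ≈-trans {x} {y} {u} x≈y y≈u =
    ∣⇒≈ (∣-resp (identity x y u) (Signed.∣m∣n⇒∣m+n (≈⇒∣ x≈y) (≈⇒∣ y≈u)))
    where
    identity : ∀ x y u → (x - y) + (y - u) ≡ x - u
    identity = solve-∀

  +-cong : x ≈ y → u ≈ v → x + u ≈ y + v
  +-cong {x} {y} {u} {v} x≈y u≈v =
    ∣⇒≈ (∣-resp (identity x y u v) (Signed.∣m∣n⇒∣m+n (≈⇒∣ x≈y) (≈⇒∣ u≈v)))
    where
    identity : ∀ x y u v → (x - y) + (u - v) ≡ (x + u) - (y + v)
    identity = solve-∀

  *-cong : x ≈ y → u ≈ v → x * u ≈ y * v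
  *-cong {x} {y} {u} {v} x≈y u≈v =
    ∣⇒≈ (∣-resp (identity x y u v)
                (Signed.∣m∣n⇒∣m+n (Signed.∣m⇒∣m*n u (≈⇒∣ x≈y)) (Signed.∣n⇒∣m*n y (≈⇒∣ u≈v))))
    where
    identity : ∀ x y u v → (x - y) * u + y * (u - v) ≡ x * u - y * v
    identity = solve-∀

  -‿cong : x ≈ y → - x ≈ - y
  -‿cong {x} {y} x≈y = ∣⇒≈ (∣-resp (identity x y) (Signed.∣m⇒∣-m (≈⇒∣ x≈y)))
    where
    identity : ∀ x y → - (x - y) ≡ - x - - y
    identity = solve-∀

  +-congˡ : ∀ x → u ≈ v → x + u ≈ x + v
  +-congˡ x = +-cong (≈-refl {x = x})

  +-congʳ : ∀ w → x ≈ y → x + w ≈ y + w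
  +-congʳ w x≈y = +-cong x≈y (≈-refl {x = w})

  *-congˡ : ∀ x → u ≈ v → x * u ≈ x * v
  *-congˡ x = *-cong (≈-refl {x = x})

  *-congʳ : ∀ w → x ≈ y → x * w ≈ y * w
  *-congʳ w x≈y = *-cong x≈y (≈-refl {x = w})

  ^-cong : ∀ n → x ≈ y → x ^ n ≈ y ^ n
  ^-cong zero    _   = ≈-refl
  ^-cong (suc n) x≈y = *-cong x≈y (^-cong n x≈y)

  setoid : Setoid 0ℓ 0ℓ
  setoid = record
    { Carrier       = ℤ
    ; _≈_           = _≈_
    ; isEquivalence = record { refl = ≈-refl ; sym = ≈-sym ; trans = ≈-trans }
    }

  module ≈-Reasoning = SetoidReasoning setoid

  ≈-by-vanishing : ∀ {z} w → z ≈ 0ℤ → x ≡ y + z * w → x ≈ y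
  ≈-by-vanishing {x} {y} {z} w z≈0 eq = begin
    x             ≡⟨ eq ⟩
    y + z * w     ≈⟨ +-congˡ y (*-congʳ w z≈0) ⟩
    y + 0ℤ * w    ≡⟨ ℤₚ.+-identityʳ y ⟩
    y             ∎
    where open ≈-Reasoning

  ^-inverse : ∀ n → x * y ≈ 1ℤ → x ^ n * y ^ n ≈ 1ℤ
  ^-inverse {x} {y} n xy≈1 = begin
    x ^ n * y ^ n   ≡⟨ ^-distribʳ-* x y n ⟨
    (x * y) ^ n     ≈⟨ ^-cong n xy≈1 ⟩
    1ℤ ^ n          ≡⟨ ℤₚ.^-zeroˡ n ⟩
    1ℤ              ∎
    where open ≈-Reasoning

  ^-cancelˡ : ∀ i d → y * x ≈ 1ℤ → x ^ i ≈ x ^ (i ℕ.+ d) → x ^ d ≈ 1ℤ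
  ^-cancelˡ {y} {x} i d yx≈1 xⁱ≈xⁱ⁺ᵈ = begin
    x ^ d                   ≡⟨ ℤₚ.*-identityˡ (x ^ d) ⟨
    1ℤ * x ^ d              ≈⟨ *-congʳ (x ^ d) (^-inverse i yx≈1) ⟨
    y ^ i * x ^ i * x ^ d   ≡⟨ ℤₚ.*-assoc (y ^ i) (x ^ i) (x ^ d) ⟩
    y ^ i * (x ^ i * x ^ d) ≡⟨ cong (y ^ i *_) (ℤₚ.^-distribˡ-+-* x i d) ⟨
    y ^ i * x ^ (i ℕ.+ d)   ≈⟨ *-congˡ (y ^ i) xⁱ≈xⁱ⁺ᵈ ⟨
    y ^ i * x ^ i           ≈⟨ ^-inverse i yx≈1 ⟩
    1ℤ                      ∎
    where open ≈-Reasoning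

  ^-periodic : ∀ e n .{{_ : ℕ.NonZero e}} → x ^ e ≈ 1ℤ → x ^ n ≈ x ^ (n % e)
  ^-periodic {x} e n xᵉ≈1 = begin
    x ^ n                             ≡⟨ cong (x ^_) (m≡m%n+[m/n]*n n e) ⟩
    x ^ (n % e ℕ.+ n / e ℕ.* e)       ≡⟨ ℤₚ.^-distribˡ-+-* x (n % e) (n / e ℕ.* e) ⟩
    x ^ (n % e) * x ^ (n / e ℕ.* e)   ≡⟨ cong (λ m → x ^ (n % e) * x ^ m) (ℕₚ.*-comm (n / e) e) ⟩
    x ^ (n % e) * x ^ (e ℕ.* (n / e)) ≡⟨ cong (x ^ (n % e) *_) (ℤₚ.^-*-assoc x e (n / e)) ⟨
    x ^ (n % e) * (x ^ e) ^ (n / e)   ≈⟨ *-congˡ (x ^ (n % e)) (^-cong (n / e) xᵉ≈1) ⟩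
    x ^ (n % e) * 1ℤ ^ (n / e)        ≡⟨ cong (x ^ (n % e) *_) (ℤₚ.^-zeroˡ (n / e)) ⟩
    x ^ (n % e) * 1ℤ                  ≡⟨ ℤₚ.*-identityʳ (x ^ (n % e)) ⟩
    x ^ (n % e)                       ∎
    where open ≈-Reasoning

  +n≈+[n%p] : ∀ n .{{_ : ℕ.NonZero p}} → + n ≈ + (n % p)
  +n≈+[n%p] n = ≈-by-multiple (+ (n / p)) (begin
    + n - + (n % p)                          ≡⟨ cong (λ m → + m - + (n % p)) (m≡m%n+[m/n]*n n p) ⟩
    + (n % p ℕ.+ n / p ℕ.* p) - + (n % p)    ≡⟨ cong (_- + (n % p)) (ℤₚ.pos-+ (n % p) (n / p ℕ.* p)) ⟩
    + (n % p) + + (n / p ℕ.* p) - + (n % p)  ≡⟨ cancel (+ (n % p)) (+ (n / p ℕ.* p)) ⟩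
    + (n / p ℕ.* p)                          ≡⟨ ℤₚ.pos-* (n / p) p ⟩
    + (n / p) * + p                          ∎)
    where
    open ≡-Reasoning
    cancel : ∀ a b → a + b - a ≡ b
    cancel = solve-∀

  ≉-small : ∀ {x y} .{{_ : ℕ.NonZero ∣ x - y ∣}} → ∣ x - y ∣ < p → x ≉ y
  ≉-small small (wrap p∣x-y) = >⇒∤ small p∣x-y

  ≤-small-≈⇒≡ : ∀ {a b} → a ≤ b → b < p → + a ≈ + b → a ≡ b
  ≤-small-≈⇒≡ {a} {b} a≤b b<p (wrap p∣a-b) =
    ℕₚ.≤-antisym a≤b (ℕₚ.m∸n≡0⇒m≤n (<∧∣⇒≡0 (ℕₚ.≤-<-trans (ℕₚ.m∸n≤m b a) b<p) p∣b-a))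
    where
    ∣a-b∣≡b∸a : ∣ + a - + b ∣ ≡ b ℕ.∸ a
    ∣a-b∣≡b∸a = trans (cong ∣_∣ (ℤₚ.[+m]-[+n]≡m⊖n a b)) (ℤₚ.∣⊖∣-≤ a≤b)
    p∣b-a : p ℕ∣.∣ b ℕ.∸ a
    p∣b-a = subst (p ℕ∣.∣_) ∣a-b∣≡b∸a p∣a-b

  small-≈⇒≡ : ∀ {a b} → a < p → b < p → + a ≈ + b → a ≡ b
  small-≈⇒≡ {a} {b} a<p b<p a≈b with ℕₚ.≤-total a b
  ... | inj₁ a≤b = ≤-small-≈⇒≡ a≤b b<p a≈b
  ... | inj₂ b≤a = sym (≤-small-≈⇒≡ b≤a a<p (≈-sym a≈b))

  _≈?_ : ∀ x y → Dec (x ≈ y)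
  x ≈? y = map′ wrap unwrap (p ℕ∣.∣? ∣ x - y ∣)

  _≈±1 : ℤ → Set
  x ≈±1 = x ≈ 1ℤ ⊎ x ≈ -1ℤ

  ≈±1-resp : x ≈ y → x ≈±1 → y ≈±1
  ≈±1-resp x≈y = Sum.map (≈-trans (≈-sym x≈y)) (≈-trans (≈-sym x≈y))

  -‿≈±1 : x ≈±1 → - x ≈±1
  -‿≈±1 (inj₁ x≈1)  = inj₂ (-‿cong x≈1)
  -‿≈±1 (inj₂ x≈-1) = inj₁ (-‿cong x≈-1)

  -‿≈±1⁻ : - x ≈±1 → x ≈±1
  -‿≈±1⁻ {x} -x≈±1 = ≈±1-resp (≡⇒≈ (ℤₚ.neg-involutive x)) (-‿≈±1 -x≈±1)

  -‿^-≈±1⁻ : ∀ n → (- x) ^ n ≈±1 → x ^ n ≈±1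
  -‿^-≈±1⁻ {x} n with -‿^ x n
  ... | inj₁ eq = ≈±1-resp (≡⇒≈ eq)
  ... | inj₂ eq = -‿≈±1⁻ ∘ ≈±1-resp (≡⇒≈ eq)

  -‿^-≈±1 : ∀ n → x ^ n ≈±1 → (- x) ^ n ≈±1
  -‿^-≈±1 {x} n with -‿^ x n
  ... | inj₁ eq = ≈±1-resp (≡⇒≈ (sym eq))
  ... | inj₂ eq = ≈±1-resp (≡⇒≈ (sym eq)) ∘ -‿≈±1

  ≈±1⇒x*x≈1 : x ≈±1 → x * x ≈ 1ℤ
  ≈±1⇒x*x≈1 (inj₁ x≈1)  = *-cong x≈1 x≈1
  ≈±1⇒x*x≈1 (inj₂ x≈-1) = *-cong x≈-1 x≈-1

  ±1-self-inverse : y ≈±1 → x * y ≈ 1ℤ → x ≈ y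
  ±1-self-inverse {y} {x} y≈±1 xy≈1 = begin
    x            ≡⟨ ℤₚ.*-identityʳ x ⟨
    x * 1ℤ       ≈⟨ *-congˡ x (≈±1⇒x*x≈1 y≈±1) ⟨
    x * (y * y)  ≡⟨ rearrange x y ⟩
    y * (x * y)  ≈⟨ *-congˡ y xy≈1 ⟩
    y * 1ℤ       ≡⟨ ℤₚ.*-identityʳ y ⟩
    y            ∎
    where
    open ≈-Reasoning
    rearrange : ∀ x y → x * (y * y) ≡ y * (x * y)
    rearrange = solve-∀

  ≈±1-inverse : x * y ≈ 1ℤ → y ≈±1 → x ≈±1
  ≈±1-inverse xy≈1 y≈±1 = ≈±1-resp (≈-sym (±1-self-inverse y≈±1 xy≈1)) y≈±1

  x*x≈1⇒x≈±1 : Prime p → x * x ≈ 1ℤ → x ≈±1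
  x*x≈1⇒x≈±1 {x} p-prime (wrap p∣x²-1) =
    Sum.map wrap wrap (euclidsLemma ∣ x - 1ℤ ∣ ∣ x + 1ℤ ∣ p-prime p∣product)
    where
    factor : ∀ x → x * x - 1ℤ ≡ (x - 1ℤ) * (x + 1ℤ)
    factor = solve-∀
    p∣product : p ℕ∣.∣ ∣ x - 1ℤ ∣ ℕ.* ∣ x + 1ℤ ∣
    p∣product = subst (p ℕ∣.∣_) (trans (cong ∣_∣ (factor x)) (ℤₚ.abs-* (x - 1ℤ) (x + 1ℤ))) p∣x²-1

  infix 4 _≋_
  record _≋_ (X Y : Mat) : Set where
    constructor mk≋
    field
      m11≈ : Mat.m11 X ≈ Mat.m11 Y
      m12≈ : Mat.m12 X ≈ Mat.m12 Y
      m21≈ : Mat.m21 X ≈ Mat.m21 Y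
      m22≈ : Mat.m22 X ≈ Mat.m22 Y
  open _≋_ public

  ≡⇒≋ : ∀ {X Y} → X ≡ Y → X ≋ Y
  ≡⇒≋ refl = mk≋ ≈-refl ≈-refl ≈-refl ≈-refl

  ≋-trans : ∀ {X Y Z} → X ≋ Y → Y ≋ Z → X ≋ Z
  ≋-trans (mk≋ a b c d) (mk≋ a′ b′ c′ d′) =
    mk≋ (≈-trans a a′) (≈-trans b b′) (≈-trans c c′) (≈-trans d d′)

  ⊗-cong : ∀ {X X′ Y Y′} → X ≋ X′ → Y ≋ Y′ → X ⊗ Y ≋ X′ ⊗ Y′
  ⊗-cong (mk≋ a b c d) (mk≋ e f g h) =
    mk≋ (+-cong (*-cong a e) (*-cong b g)) (+-cong (*-cong a f) (*-cong b h))
        (+-cong (*-cong c e) (*-cong d g)) (+-cong (*-cong c f) (*-cong d h))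

  M-cong : ∀ {xs ys} → xs ≈[ p ] ys → M xs ≋ M ys
  M-cong []                         = ≡⇒≋ refl
  M-cong {x ∷ xs} {y ∷ ys} (x≈y ∷ xs≈ys) =
    ≋-trans (≡⇒≋ (M-∷ x xs))
      (≋-trans (⊗-cong {M xs} {M ys} {step x} {step y} (M-cong xs≈ys) step-x≋step-y)
        (≡⇒≋ (sym (M-∷ y ys))))
    where
    step-x≋step-y : step x ≋ step y
    step-x≋step-y = mk≋ (wrap x≈y) ≈-refl ≈-refl ≈-refl

  record FirstRow (R : List ℤ) (a b : ℤ) : Set where
    constructor row
    field
      entry₁₁ : Mat.m11 (M R) ≈ a
      entry₁₂ : Mat.m12 (M R) ≈ b
  open FirstRow public

  FirstRow-++ : ∀ T {R a b} → FirstRow R a b →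
                FirstRow (T ++ R) (a * Mat.m11 (M T) + b * Mat.m21 (M T)) (a * Mat.m12 (M T) + b * Mat.m22 (M T))
  FirstRow-++ T {R} (row r₁₁≈a r₁₂≈b) = row
    (≈-trans (≡⇒≈ (cong Mat.m11 (M-++ T R)))
             (+-cong (*-congʳ (Mat.m11 (M T)) r₁₁≈a) (*-congʳ (Mat.m21 (M T)) r₁₂≈b)))
    (≈-trans (≡⇒≈ (cong Mat.m12 (M-++ T R)))
             (+-cong (*-congʳ (Mat.m12 (M T)) r₁₁≈a) (*-congʳ (Mat.m22 (M T)) r₁₂≈b)))

  FirstRow-repeat : ∀ {B a} → FirstRow B a 0ℤ → ∀ j → FirstRow (repeat j B) (a ^ j) 0ℤ
  FirstRow-repeat         _                     zero    = row ≈-refl ≈-refl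
  FirstRow-repeat {B} {a} B-row@(row b₁₁≈a b₁₂≈0) (suc j) =
    row (≈-trans (entry₁₁ next) (absorb (Mat.m21 (M B)) b₁₁≈a))
        (≈-trans (entry₁₂ next) (absorb (Mat.m22 (M B)) b₁₂≈0))
    where
    next = FirstRow-++ B (FirstRow-repeat B-row j)
    absorb : ∀ {b e} c → b ≈ e → a ^ j * b + 0ℤ * c ≈ e * a ^ j
    absorb {e = e} c b≈e = ≈-trans (+-congʳ (0ℤ * c) (*-congˡ (a ^ j) b≈e)) (≡⇒≈ (identity (a ^ j) e c))
      where
      identity : ∀ u e c → u * e + 0ℤ * c ≡ e * u
      identity = solve-∀

  FirstRow-[x,y,z] : ∀ x y z {a b} → z * x * y - z - x ≈ a → 1ℤ - z * y ≈ b → FirstRow (x ∷ y ∷ z ∷ []) a b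
  FirstRow-[x,y,z] x y z m₁₁≈a m₁₂≈b =
    row (≈-trans (≡⇒≈ (cong Mat.m11 (M-[x,y,z] x y z))) m₁₁≈a)
        (≈-trans (≡⇒≈ (cong Mat.m12 (M-[x,y,z] x y z))) m₁₂≈b)

  m11-∷ : ∀ {R a b} x → FirstRow R a b → Mat.m11 (M (x ∷ R)) ≈ a * x + b * 1ℤ
  m11-∷ {R} {a} {b} x R-row =
    ≈-trans (entry₁₁ (FirstRow-++ [ x ] R-row))
            (≡⇒≈ (cong (λ X → a * Mat.m11 X + b * Mat.m21 X) (M-[x] x)))

  m11-∷∷ : ∀ {R a b} x y → FirstRow R a b → Mat.m11 (M (x ∷ y ∷ R)) ≈ a * (y * x - 1ℤ) + b * x
  m11-∷∷ {R} {a} {b} x y R-row =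
    ≈-trans (entry₁₁ (FirstRow-++ (x ∷ y ∷ []) R-row))
            (≡⇒≈ (cong (λ X → a * Mat.m11 X + b * Mat.m21 X) (M-[x,y] x y)))

  quiddity⇒m22≈±1 : ∀ c → IsQuiddity p c → Mat.m22 (M c) ≈±1
  quiddity⇒m22≈±1 _ (inj₁ (_ , _ , _ , m22≡1))  = inj₁ (wrap m22≡1)
  quiddity⇒m22≈±1 _ (inj₂ (_ , _ , _ , m22≡-1)) = inj₂ (wrap m22≡-1)

  scalar⇒quiddity : ∀ c {s} → M c ≋ mat s 0ℤ 0ℤ s → s ≈±1 → IsQuiddity p c
  scalar⇒quiddity _ (mk≋ a b c d) (inj₁ s≈1) =
    inj₁ (unwrap (≈-trans a s≈1) , unwrap b , unwrap c , unwrap (≈-trans d s≈1))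
  scalar⇒quiddity _ (mk≋ a b c d) (inj₂ s≈-1) =
    inj₂ (unwrap (≈-trans a s≈-1) , unwrap b , unwrap c , unwrap (≈-trans d s≈-1))

  -- Mat.m11 (M L) is the continuant of L. A reduction c ∼ a ⊕ b makes the inner entries of b such a
  -- suffix of a rotation of c or of its reverse.
  record UnitSuffix (L : List ℤ) : Set where
    constructor unit-suffix
    field
      prefix suffix   : List ℤ
      split           : L ≡ prefix ++ suffix
      prefix-long     : 3 ≤ length prefix
      suffix-nonempty : 0 < length suffix
      suffix-unit     : Mat.m11 (M suffix) ≈±1

  ++-unit⇒UnitSuffix : ∀ {m n L} (u : Vec ℤ (3 ℕ.+ m)) (w : Vec ℤ (suc n)) →
                       Mat.m11 (M (Vec.toList w)) ≈±1 → (Vec.toList u ++ Vec.toList w) ≈[ p ] L → UnitSuffix L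
  ++-unit⇒UnitSuffix {m} u w w-unit u++w≈L
    with L₁ , L₂ , refl , u≈L₁ , w≈L₂ ← Pointwise-++⁻ (Vec.toList u) u++w≈L
    = record
      { prefix = L₁ ; suffix = L₂ ; split = refl
      ; prefix-long     = subst (3 ≤_) (length≡ u u≈L₁) (ℕₚ.m≤m+n 3 m)
      ; suffix-nonempty = subst (0 <_) (length≡ w w≈L₂) (s≤s z≤n)
      ; suffix-unit     = ≈±1-resp (m11≈ (M-cong w≈L₂)) w-unit
      }
    where
    length≡ : ∀ {k L} (v : Vec ℤ k) → Vec.toList v ≈[ p ] L → k ≡ length L
    length≡ v v≈L = trans (sym (Vecₚ.length-toList v)) (Pointwise-length v≈L)

  ⊕-quiddity⇒UnitSuffix : ∀ {m n} (a : Vec ℤ (3 ℕ.+ m)) (b : Vec ℤ (3 ℕ.+ n)) {L} →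
                           IsQuiddity p (Vec.toList b) → (a ⊕ b) ≈[ p ] L → UnitSuffix L
  ⊕-quiddity⇒UnitSuffix {m} (x Vec.∷ xs) (y Vec.∷ ys) {L} quid a⊕b≈L =
    ++-unit⇒UnitSuffix a′ (Vec.init ys) W-unit (subst (_≈[ p ] L) shape a⊕b≈L)
    where
    middle : ℤ
    middle = Vec.last xs + y
    a′ : Vec ℤ (3 ℕ.+ m)
    a′ = (x + Vec.last ys) Vec.∷ (Vec.init xs Vec.∷ʳ middle)
    W : List ℤ
    W = Vec.toList (Vec.init ys)
    shape : (x Vec.∷ xs) ⊕ (y Vec.∷ ys) ≡ Vec.toList a′ ++ W
    shape = cong (x + Vec.last ys ∷_) (begin
      I ++ middle ∷ W                             ≡⟨ Listₚ.++-assoc I [ middle ] W ⟨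
      (I ++ [ middle ]) ++ W                      ≡⟨ cong (_++ W) (Vecₚ.toList-∷ʳ middle (Vec.init xs)) ⟨
      Vec.toList (Vec.init xs Vec.∷ʳ middle) ++ W ∎)
      where
      open ≡-Reasoning
      I = Vec.toList (Vec.init xs)
    W-unit : Mat.m11 (M W) ≈±1
    W-unit = -‿≈±1⁻ (≈±1-resp (≡⇒≈ m22≡) (quiddity⇒m22≈±1 (y ∷ Vec.toList ys) quid))
      where
      m22≡ : Mat.m22 (M (y ∷ Vec.toList ys)) ≡ - Mat.m11 (M W)
      m22≡ = trans (cong (λ t → Mat.m22 (M (y ∷ t))) (toList-init-last ys)) (m22-M-∷-∷ʳ y W (Vec.last ys))

  reducible⇒UnitSuffix : ∀ {c} → Reducible p c →
                         ∃ λ r → UnitSuffix (rotN r c) ⊎ UnitSuffix (rotN r (reverse c))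
  reducible⇒UnitSuffix (_ , _ , a , b , quid , r , c∼a⊕b) =
    r , Sum.map (⊕-quiddity⇒UnitSuffix a b quid) (⊕-quiddity⇒UnitSuffix a b quid) c∼a⊕b

-- 2 as a primitive root modulo p = 2k + 1

module TwoIsPrimitiveRoot (k : ℕ) (p-prime : Prime (suc (2 ℕ.* k)))
                          (two-generates : TwoGenerates (suc (2 ℕ.* k))) where

  p 2k : ℕ
  p  = suc (2 ℕ.* k)
  2k = 2 ℕ.* k

  open Modulo p

  ½ : ℤ
  ½ = + suc k

  1≤k : 1 ≤ k
  1≤k = ℕₚ.n≢0⇒n>0 λ k≡0 → ¬prime[1] (subst (λ n → Prime (suc (2 ℕ.* n))) k≡0 p-prime)

  k<2k : k < 2k
  k<2k = subst (k <_) (n+n≡2*n k) (ℕₚ.m<m+n k 1≤k)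

  2<p : 2 < p
  2<p = s≤s (ℕₚ.*-monoʳ-≤ 2 1≤k)

  1<p : 1 < p
  1<p = ℕₚ.<-trans (ℕₚ.n<1+n 1) 2<p

  1≉-1 : 1ℤ ≉ -1ℤ
  1≉-1 = ≉-small 2<p

  0≉±1 : ¬ 0ℤ ≈±1
  0≉±1 = [ ≉-small 1<p , ≉-small 1<p ]′

  2½≈1 : 2ℤ * ½ ≈ 1ℤ
  2½≈1 = ≈-by-multiple 1ℤ (trans (identity (+ k)) (cong (λ m → 1ℤ * (1ℤ + m)) (sym (ℤₚ.pos-* 2 k))))
    where
    identity : ∀ m → 2ℤ * (1ℤ + m) - 1ℤ ≡ 1ℤ * (1ℤ + 2ℤ * m)
    identity = solve-∀

  2½-1≈0 : 2ℤ * ½ - 1ℤ ≈ 0ℤ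
  2½-1≈0 = +-congʳ -1ℤ 2½≈1

  ½2≈1 : ½ * 2ℤ ≈ 1ℤ
  ½2≈1 = ≈-trans (≡⇒≈ (ℤₚ.*-comm ½ 2ℤ)) 2½≈1

  log : ∀ x → x ≉ 0ℤ → ∃ λ n → 2ℤ ^ n ≈ x
  log x x≉0 = Product.map₂ wrap (two-generates x (x≉0 ∘ wrap ∘ p∣x⇒p∣x-0))
    where
    p∣x⇒p∣x-0 : p ℕ∣.∣ ∣ x ∣ → p ℕ∣.∣ ∣ x - 0ℤ ∣
    p∣x⇒p∣x-0 = subst (λ y → p ℕ∣.∣ ∣ y ∣) (sym (ℤₚ.+-identityʳ x))

  +suc≉0 : ∀ {a} → suc a < p → + suc a ≉ 0ℤ
  +suc≉0 a<p a≈0 = ℕₚ.1+n≢0 (small-≈⇒≡ a<p (s≤s z≤n) a≈0)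

  -- Pigeonhole: reducing the logarithms of the 2k nonzero residues modulo e would identify two of them.
  2^e≉1 : ∀ {e} → 0 < e → e < 2k → 2ℤ ^ e ≉ 1ℤ
  2^e≉1 {e} 0<e e<2k 2^e≈1 = no-collision (Finₚ.pigeonhole e<2k exponent-mod-e)
    where
    instance
      e≢0 : ℕ.NonZero e
      e≢0 = ℕ.>-nonZero 0<e
    log-suc : ∀ (i : Fin 2k) → ∃ λ n → 2ℤ ^ n ≈ + suc (toℕ i)
    log-suc i = log (+ suc (toℕ i)) (+suc≉0 (s≤s (Finₚ.toℕ<n i)))
    exponent : Fin 2k → ℕ
    exponent i = proj₁ (log-suc i)
    2^exponent : ∀ i → 2ℤ ^ (exponent i % e) ≈ + suc (toℕ i)
    2^exponent i = ≈-trans (≈-sym (^-periodic e (exponent i) 2^e≈1)) (proj₂ (log-suc i))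
    exponent-mod-e : Fin 2k → Fin e
    exponent-mod-e i = Fin.fromℕ< (m%n<n (exponent i) e)
    no-collision : ¬ ∃₂ λ i j → i Fin.< j × exponent-mod-e i ≡ exponent-mod-e j
    no-collision (i , j , i<j , same) =
      Finₚ.<⇒≢ i<j (Finₚ.toℕ-injective (ℕₚ.suc-injective (small-≈⇒≡ (s≤s (Finₚ.toℕ<n i)) (s≤s (Finₚ.toℕ<n j)) i≈j)))
      where
      open ≈-Reasoning
      i≈j : + suc (toℕ i) ≈ + suc (toℕ j)
      i≈j = begin
        + suc (toℕ i)              ≈⟨ 2^exponent i ⟨
        2ℤ ^ (exponent i % e)      ≡⟨ cong (2ℤ ^_) (Finₚ.fromℕ<-injective _ _ _ _ same) ⟩
        2ℤ ^ (exponent j % e)      ≈⟨ 2^exponent j ⟩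
        + suc (toℕ j)              ∎

  residues-collide : (f : Fin p → ℕ) → (∀ i → + f i ≉ 0ℤ) →
                     ∃₂ λ i j → i Fin.< j × + f i ≈ + f j
  residues-collide f f≉0 = collision (Finₚ.pigeonhole (ℕₚ.n<1+n 2k) nonzero-residue)
    where
    residue≢0 : ∀ i → Fin.zero ≢ f i mod p
    residue≢0 i 0≡residue = f≉0 i (≈-trans (+n≈+[n%p] (f i))
      (≡⇒≈ (cong +_ (trans (sym (Finₚ.toℕ-fromℕ< (m%n<n (f i) p))) (cong toℕ (sym 0≡residue))))))
    nonzero-residue : Fin p → Fin 2k
    nonzero-residue i = Fin.punchOut (residue≢0 i)
    collision : (∃₂ λ i j → i Fin.< j × nonzero-residue i ≡ nonzero-residue j) →
                ∃₂ λ i j → i Fin.< j × + f i ≈ + f j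
    collision (i , j , i<j , same) = i , j , i<j , (begin
      + f i          ≈⟨ +n≈+[n%p] (f i) ⟩
      + (f i % p)    ≡⟨ cong +_ (Finₚ.fromℕ<-injective _ _ _ _ residues≡) ⟩
      + (f j % p)    ≈⟨ +n≈+[n%p] (f j) ⟨
      + f j          ∎)
      where
      open ≈-Reasoning
      residues≡ : f i mod p ≡ f j mod p
      residues≡ = Finₚ.punchOut-injective (residue≢0 i) (residue≢0 j) same

  -- Two of 2⁰, …, 2^2k agree modulo p; the difference d ≤ 2k of their exponents has 2^d ≈ 1, so d = 2k.
  2^2k≈1 : 2ℤ ^ 2k ≈ 1ℤ
  2^2k≈1 = from-collision (residues-collide (λ i → 2 ℕ.^ toℕ i) 2^i≉0)
    where
    2^i≉0 : ∀ i → + (2 ℕ.^ toℕ i) ≉ 0ℤ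
    2^i≉0 i 2^i≈0 = 0≉±1 (inj₁ (begin
      0ℤ                                ≡⟨⟩
      0ℤ * ½ ^ toℕ i                    ≈⟨ *-congʳ (½ ^ toℕ i) 2^i≈0 ⟨
      + (2 ℕ.^ toℕ i) * ½ ^ toℕ i       ≡⟨ cong (_* ½ ^ toℕ i) (pos-^ 2 (toℕ i)) ⟩
      2ℤ ^ toℕ i * ½ ^ toℕ i            ≈⟨ ^-inverse (toℕ i) 2½≈1 ⟩
      1ℤ                                ∎))
      where open ≈-Reasoning
    from-collision : (∃₂ λ i j → i Fin.< j × + (2 ℕ.^ toℕ i) ≈ + (2 ℕ.^ toℕ j)) → 2ℤ ^ 2k ≈ 1ℤ
    from-collision (i , j , i<j , 2ⁱ≈2ʲ) = subst (λ e → 2ℤ ^ e ≈ 1ℤ) d≡2k 2^d≈1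
      where
      d : ℕ
      d = toℕ j ℕ.∸ toℕ i
      2^d≈1 : 2ℤ ^ d ≈ 1ℤ
      2^d≈1 = ^-cancelˡ {y = ½} (toℕ i) d ½2≈1 (begin
        2ℤ ^ toℕ i               ≡⟨ pos-^ 2 (toℕ i) ⟨
        + (2 ℕ.^ toℕ i)          ≈⟨ 2ⁱ≈2ʲ ⟩
        + (2 ℕ.^ toℕ j)          ≡⟨ pos-^ 2 (toℕ j) ⟩
        2ℤ ^ toℕ j               ≡⟨ cong (2ℤ ^_) (ℕₚ.m+[n∸m]≡n (ℕₚ.<⇒≤ i<j)) ⟨
        2ℤ ^ (toℕ i ℕ.+ d)       ∎)
        where open ≈-Reasoning
      d≡2k : d ≡ 2k
      d≡2k = ℕₚ.≤∧≮⇒≡ (ℕₚ.≤-trans (ℕₚ.m∸n≤m (toℕ j) (toℕ i)) (ℕₚ.<⇒≤pred (Finₚ.toℕ<n j)))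
                      (λ d<2k → 2^e≉1 (ℕₚ.m<n⇒0<n∸m i<j) d<2k 2^d≈1)

  2^k*2^k≈1 : 2ℤ ^ k * 2ℤ ^ k ≈ 1ℤ
  2^k*2^k≈1 = begin
    2ℤ ^ k * 2ℤ ^ k    ≡⟨ ℤₚ.^-distribˡ-+-* 2ℤ k k ⟨
    2ℤ ^ (k ℕ.+ k)     ≡⟨ cong (2ℤ ^_) (n+n≡2*n k) ⟩
    2ℤ ^ 2k            ≈⟨ 2^2k≈1 ⟩
    1ℤ                 ∎
    where open ≈-Reasoning

  2^k≈-1 : 2ℤ ^ k ≈ -1ℤ
  2^k≈-1 with x*x≈1⇒x≈±1 p-prime 2^k*2^k≈1
  ... | inj₁ 2^k≈1  = ⊥-elim (2^e≉1 1≤k k<2k 2^k≈1)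
  ... | inj₂ 2^k≈-1 = 2^k≈-1

  2^e≉±1 : ∀ {e} → 0 < e → e < k → ¬ 2ℤ ^ e ≈±1
  2^e≉±1 0<e e<k (inj₁ 2^e≈1) = 2^e≉1 0<e (ℕₚ.<-trans e<k k<2k) 2^e≈1
  2^e≉±1 {e} 0<e e<k (inj₂ 2^e≈-1) =
    2^e≉1 (ℕₚ.<-≤-trans 0<e (ℕₚ.m≤m+n e e)) (subst (e ℕ.+ e <_) (n+n≡2*n k) (ℕₚ.+-mono-< e<k e<k))
    (begin
      2ℤ ^ (e ℕ.+ e)        ≡⟨ ℤₚ.^-distribˡ-+-* 2ℤ e e ⟩
      2ℤ ^ e * 2ℤ ^ e       ≈⟨ *-cong 2^e≈-1 2^e≈-1 ⟩
      -1ℤ * -1ℤ             ≡⟨⟩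
      1ℤ                    ∎)
    where open ≈-Reasoning

  -- Euler's criterion: x ≈ 2ⁿ gives (x * x)^k ≈ (2^2k)ⁿ ≈ 1, whereas 2^k ≈ -1.
  x*x≉2 : ∀ x → x * x ≉ 2ℤ
  x*x≉2 x x²≈2 with x ≈? 0ℤ
  ... | yes x≈0 = ≉-small 2<p (≈-trans (≈-sym (*-cong x≈0 x≈0)) x²≈2)
  ... | no x≉0  with n , 2ⁿ≈x ← log x x≉0 = 1≉-1 (begin
    1ℤ                          ≡⟨ ℤₚ.^-zeroˡ n ⟨
    1ℤ ^ n                      ≈⟨ ^-cong n 2^2k≈1 ⟨
    (2ℤ ^ 2k) ^ n               ≡⟨ ℤₚ.^-*-assoc 2ℤ 2k n ⟩
    2ℤ ^ (2k ℕ.* n)             ≡⟨ cong (2ℤ ^_) (exponents k n) ⟩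
    2ℤ ^ ((n ℕ.+ n) ℕ.* k)      ≡⟨ ℤₚ.^-*-assoc 2ℤ (n ℕ.+ n) k ⟨
    (2ℤ ^ (n ℕ.+ n)) ^ k        ≡⟨ cong (_^ k) (ℤₚ.^-distribˡ-+-* 2ℤ n n) ⟩
    (2ℤ ^ n * 2ℤ ^ n) ^ k       ≈⟨ ^-cong k (*-cong 2ⁿ≈x 2ⁿ≈x) ⟩
    (x * x) ^ k                 ≈⟨ ^-cong k x²≈2 ⟩
    2ℤ ^ k                      ≈⟨ 2^k≈-1 ⟩
    -1ℤ                         ∎)
    where
    open ≈-Reasoning
    exponents : ∀ k n → 2 ℕ.* k ℕ.* n ≡ (n ℕ.+ n) ℕ.* k
    exponents = ℕSolver.solve-∀

  -- The λ-quiddity (2, ½, ½)^k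

  μ ν : ℕ → ℤ
  μ j = (- 2ℤ) ^ j
  ν j = (- ½) ^ j

  μν≈1 : ∀ j → μ j * ν j ≈ 1ℤ
  μν≈1 j = ^-inverse j (≈-trans (≡⇒≈ (signs ½)) 2½≈1)
    where
    signs : ∀ h → - 2ℤ * - h ≡ 2ℤ * h
    signs = solve-∀

  μ≉±1 : ∀ {e} → 0 < e → e < k → ¬ μ e ≈±1
  μ≉±1 {e} 0<e e<k = 2^e≉±1 0<e e<k ∘ -‿^-≈±1⁻ e

  ν≉±1 : ∀ {e} → 0 < e → e < k → ¬ ν e ≈±1
  ν≉±1 {e} 0<e e<k = 2^e≉±1 0<e e<k ∘ ≈±1-inverse (^-inverse e 2½≈1) ∘ -‿^-≈±1⁻ e

  B₁ B₂ B₃ : List ℤ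
  B₁ = 2ℤ ∷ ½ ∷ ½ ∷ []
  B₂ = ½ ∷ ½ ∷ 2ℤ ∷ []
  B₃ = ½ ∷ 2ℤ ∷ ½ ∷ []

  M-B₁ : M B₁ ≋ mat (- 2ℤ) (1ℤ - ½ * ½) 0ℤ (- ½)
  M-B₁ = ≋-trans (≡⇒≋ (M-[x,y,z] 2ℤ ½ ½))
                 (mk≋ (≈-by-vanishing ½ 2½-1≈0 (e₁₁ ½)) ≈-refl
                      (≈-by-vanishing 1ℤ 2½-1≈0 (e₂₁ ½)) ≈-refl)
    where
    e₁₁ : ∀ h → h * 2ℤ * h - h - 2ℤ ≡ - 2ℤ + (2ℤ * h - 1ℤ) * h
    e₁₁ = solve-∀
    e₂₁ : ∀ h → 2ℤ * h - 1ℤ ≡ 0ℤ + (2ℤ * h - 1ℤ) * 1ℤ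
    e₂₁ = solve-∀

  FirstRow-B₂ : FirstRow B₂ (- 2ℤ) 0ℤ
  FirstRow-B₂ = FirstRow-[x,y,z] ½ ½ 2ℤ (≈-by-vanishing ½ 2½-1≈0 (e₁₁ ½)) (≈-by-vanishing -1ℤ 2½-1≈0 (e₁₂ ½))
    where
    e₁₁ : ∀ h → 2ℤ * h * h - 2ℤ - h ≡ - 2ℤ + (2ℤ * h - 1ℤ) * h
    e₁₁ = solve-∀
    e₁₂ : ∀ h → 1ℤ - 2ℤ * h ≡ 0ℤ + (2ℤ * h - 1ℤ) * -1ℤ
    e₁₂ = solve-∀

  FirstRow-B₃ : FirstRow B₃ (- ½) 0ℤ
  FirstRow-B₃ = FirstRow-[x,y,z] ½ 2ℤ ½ (≈-by-vanishing ½ 2½-1≈0 (e₁₁ ½)) (≈-by-vanishing -1ℤ 2½-1≈0 (e₁₂ ½))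
    where
    e₁₁ : ∀ h → h * h * 2ℤ - h - h ≡ - h + (2ℤ * h - 1ℤ) * h
    e₁₁ = solve-∀
    e₁₂ : ∀ h → 1ℤ - h * 2ℤ ≡ 0ℤ + (2ℤ * h - 1ℤ) * -1ℤ
    e₁₂ = solve-∀

  M-repeat-B₁ : ∀ j → M (repeat j B₁) ≋ mat (μ j) (½ * (ν j - μ j)) 0ℤ (ν j)
  M-repeat-B₁ zero    = mk≋ ≈-refl (≡⇒≈ (sym (ℤₚ.*-zeroʳ ½))) ≈-refl ≈-refl
  M-repeat-B₁ (suc j) =
    ≋-trans (≡⇒≋ (M-++ B₁ (repeat j B₁)))
      (≋-trans (⊗-cong (M-repeat-B₁ j) M-B₁)
        (mk≋ (≡⇒≈ (e₁₁ (μ j) (½ * (ν j - μ j))))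
             (≈-by-vanishing (- μ j) 2½-1≈0 (e₁₂ ½ (μ j) (ν j)))
             (≡⇒≈ (e₂₁ (ν j)))
             (≡⇒≈ (e₂₂ ½ (ν j) (1ℤ - ½ * ½)))))
    where
    e₁₁ : ∀ u x → u * - 2ℤ + x * 0ℤ ≡ - 2ℤ * u
    e₁₁ = solve-∀
    e₁₂ : ∀ h u v → u * (1ℤ - h * h) + h * (v - u) * - h
                  ≡ h * (- h * v - - 2ℤ * u) + (2ℤ * h - 1ℤ) * - u
    e₁₂ = solve-∀
    e₂₁ : ∀ v → 0ℤ * - 2ℤ + v * 0ℤ ≡ 0ℤ
    e₂₁ = solve-∀
    e₂₂ : ∀ h v c → 0ℤ * c + v * - h ≡ - h * v
    e₂₂ = solve-∀

  row₁ : ∀ j → FirstRow (repeat j B₁) (μ j) (½ * (ν j - μ j))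
  row₁ j = row (m11≈ (M-repeat-B₁ j)) (m12≈ (M-repeat-B₁ j))

  row₂ : ∀ j → FirstRow (repeat j B₂) (μ j) 0ℤ
  row₂ = FirstRow-repeat FirstRow-B₂

  row₃ : ∀ j → FirstRow (repeat j B₃) (ν j) 0ℤ
  row₃ = FirstRow-repeat FirstRow-B₃

  quiddity : IsQuiddity p (repeat k B₁)
  quiddity = scalar⇒quiddity (repeat k B₁) (≋-trans (M-repeat-B₁ k) (mk≋ ≈-refl X≈0 ≈-refl ν≈μ)) μ≈±1
    where
    μ≈±1 : μ k ≈±1
    μ≈±1 = -‿^-≈±1 k (inj₂ 2^k≈-1)
    ν≈μ : ν k ≈ μ k
    ν≈μ = ±1-self-inverse μ≈±1 (≈-trans (≡⇒≈ (ℤₚ.*-comm (ν k) (μ k))) (μν≈1 k))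
    X≈0 : ½ * (ν k - μ k) ≈ 0ℤ
    X≈0 = begin
      ½ * (ν k - μ k)   ≈⟨ *-congˡ ½ (+-congʳ (- μ k) ν≈μ) ⟩
      ½ * (μ k - μ k)   ≡⟨ cong (½ *_) (ℤₚ.+-inverseʳ (μ k)) ⟩
      ½ * 0ℤ            ≡⟨ ℤₚ.*-zeroʳ ½ ⟩
      0ℤ                ∎
      where open ≈-Reasoning

  -- Since 4½² ≈ 1 and u v ≈ 1, ½²v - u ≈ ε = ±1 would give (2u + ε)² ≈ 2.
  ½²v-u≉±1 : ∀ u v → u * v ≈ 1ℤ → ¬ ½ * ½ * v - u ≈±1
  ½²v-u≉±1 u v uv≈1 = [ square-root 1ℤ refl , square-root -1ℤ refl ]′
    where
    square-root : ∀ ε → ε * ε ≡ 1ℤ → ½ * ½ * v - u ≉ ε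
    square-root ε ε²≡1 ½²v-u≈ε = x*x≉2 (2ℤ * u + ε) (begin
      (2ℤ * u + ε) * (2ℤ * u + ε)
        ≡⟨ expand ½ u v ε ⟩
      (+ 4) * u * (ε - (½ * ½ * v - u)) + 2ℤ * ½ * (2ℤ * ½) * (u * v) + ε * ε
        ≈⟨ +-cong (+-cong (*-congˡ ((+ 4) * u) ε-E≈0) (*-cong (*-cong 2½≈1 2½≈1) uv≈1))
                  (≡⇒≈ ε²≡1) ⟩
      (+ 4) * u * 0ℤ + 1ℤ * 1ℤ * 1ℤ + 1ℤ
        ≡⟨ collapse u ⟩
      2ℤ ∎)
      where
      open ≈-Reasoning
      ε-E≈0 : ε - (½ * ½ * v - u) ≈ 0ℤ
      ε-E≈0 = ≈-trans (+-congˡ ε (-‿cong ½²v-u≈ε)) (≡⇒≈ (ℤₚ.+-inverseʳ ε))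
      expand : ∀ h u v ε → (2ℤ * u + ε) * (2ℤ * u + ε)
               ≡ (+ 4) * u * (ε - (h * h * v - u)) + 2ℤ * h * (2ℤ * h) * (u * v) + ε * ε
      expand = solve-∀
      collapse : ∀ u → (+ 4) * u * 0ℤ + 1ℤ * 1ℤ * 1ℤ + 1ℤ ≡ 2ℤ
      collapse = solve-∀

  data IsBlock : List ℤ → Set where
    b₁ : IsBlock B₁
    b₂ : IsBlock B₂
    b₃ : IsBlock B₃

  length-IsBlock : ∀ {B} → IsBlock B → length B ≡ 3
  length-IsBlock b₁ = refl
  length-IsBlock b₂ = refl
  length-IsBlock b₃ = refl

  rotN-IsBlock : ∀ r {B} → IsBlock B → IsBlock (rotN r B)
  rotN-IsBlock zero    block = block
  rotN-IsBlock (suc r) block = rot-IsBlock (rotN-IsBlock r block)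
    where
    rot-IsBlock : ∀ {B} → IsBlock B → IsBlock (rot B)
    rot-IsBlock b₁ = b₂
    rot-IsBlock b₂ = b₃
    rot-IsBlock b₃ = b₁

  repeat-suffix-≉±1 : ∀ {B j L} → IsBlock B → suc j < k → RepeatSuffix B j L → ¬ Mat.m11 (M L) ≈±1
  repeat-suffix-≉±1 {j = j} b₁ j<k whole  = μ≉±1 (s≤s z≤n) j<k ∘ ≈±1-resp (m11≈ (M-repeat-B₁ (suc j)))
  repeat-suffix-≉±1 {j = j} b₁ _   from-y =
    ½²v-u≉±1 (μ j) (ν j) (μν≈1 j) ∘ ≈±1-resp (≈-trans (m11-∷∷ ½ ½ (row₁ j)) (≡⇒≈ (e ½ (μ j) (ν j))))
    where
    e : ∀ h u v → u * (h * h - 1ℤ) + h * (v - u) * h ≡ h * h * v - u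
    e = solve-∀
  repeat-suffix-≉±1 {j = j} b₁ j<k from-z =
    ν≉±1 (s≤s z≤n) j<k ∘ -‿≈±1⁻ ∘ ≈±1-resp (≈-trans (m11-∷ ½ (row₁ j)) (≡⇒≈ (e ½ (μ j) (ν j))))
    where
    e : ∀ h u v → u * h + h * (v - u) * 1ℤ ≡ - (- h * v)
    e = solve-∀
  repeat-suffix-≉±1 {j = j} b₂ j<k whole  = μ≉±1 (s≤s z≤n) j<k ∘ ≈±1-resp (entry₁₁ (row₂ (suc j)))
  repeat-suffix-≉±1 {j = j} b₂ _   from-y =
    0≉±1 ∘ ≈±1-resp (≈-trans (m11-∷∷ ½ 2ℤ (row₂ j)) (≈-by-vanishing (μ j) 2½-1≈0 (e ½ (μ j))))
    where
    e : ∀ h u → u * (2ℤ * h - 1ℤ) + 0ℤ * h ≡ 0ℤ + (2ℤ * h - 1ℤ) * u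
    e = solve-∀
  repeat-suffix-≉±1 {j = j} b₂ j<k from-z =
    μ≉±1 (s≤s z≤n) j<k ∘ -‿≈±1⁻ ∘ ≈±1-resp (≈-trans (m11-∷ 2ℤ (row₂ j)) (≡⇒≈ (e (μ j))))
    where
    e : ∀ u → u * 2ℤ + 0ℤ * 1ℤ ≡ - (- 2ℤ * u)
    e = solve-∀
  repeat-suffix-≉±1 {j = j} b₃ j<k whole  = ν≉±1 (s≤s z≤n) j<k ∘ ≈±1-resp (entry₁₁ (row₃ (suc j)))
  repeat-suffix-≉±1 {j = j} b₃ _   from-y =
    0≉±1 ∘ ≈±1-resp (≈-trans (m11-∷∷ 2ℤ ½ (row₃ j)) (≈-by-vanishing (ν j) 2½-1≈0 (e ½ (ν j))))
    where
    e : ∀ h v → v * (h * 2ℤ - 1ℤ) + 0ℤ * 2ℤ ≡ 0ℤ + (2ℤ * h - 1ℤ) * v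
    e = solve-∀
  repeat-suffix-≉±1 {j = j} b₃ j<k from-z =
    ν≉±1 (s≤s z≤n) j<k ∘ -‿≈±1⁻ ∘ ≈±1-resp (≈-trans (m11-∷ ½ (row₃ j)) (≡⇒≈ (e ½ (ν j))))
    where
    e : ∀ h v → v * h + 0ℤ * 1ℤ ≡ - (- h * v)
    e = solve-∀

  ¬UnitSuffix : ∀ {B} → IsBlock B → ¬ UnitSuffix (repeat k B)
  ¬UnitSuffix block (unit-suffix L₁ L₂ split long nonempty unit)
    with j , j<k , suffix ← proper-suffix-of-repeat k {L₁} {L₂} (length-IsBlock block) split long nonempty
    = repeat-suffix-≉±1 block j<k suffix unit

  irreducible : ¬ Reducible p (repeat k B₁)
  irreducible reducible with reducible⇒UnitSuffix reducible
  ... | r , inj₁ u = ¬UnitSuffix (rotN-IsBlock r b₁) (subst UnitSuffix (rotN-repeat r k B₁) u)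
  ... | r , inj₂ u = ¬UnitSuffix (rotN-IsBlock r b₂)
                       (subst UnitSuffix (trans (cong (rotN r) (reverse-repeat k B₁)) (rotN-repeat r k B₂)) u)

odd-prime : ∀ {p} → Prime p → p ≢ 2 → ∃ λ k → p ≡ suc (2 ℕ.* k)
odd-prime {p} p-prime p≢2 with p % 2 in p%2≡r | m%n<n p 2
... | 0           | _ =
  ⊥-elim ([ (λ ()) , p≢2 ∘ sym ]′ (prime⇒irreducible p-prime (ℕ∣.m%n≡0⇒n∣m p 2 p%2≡r)))
... | 1           | _ = p / 2 , trans (m≡m%n+[m/n]*n p 2) (cong₂ ℕ._+_ p%2≡r (ℕₚ.*-comm (p / 2) 2))
... | suc (suc _) | s≤s (s≤s ())

proposition6p9 : (p : ℕ) → Prime p → p ≢ 2 → TwoGenerates p →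
    Σ (List ℤ) λ c → IrreducibleQuiddity p c × (3 ℕ.* ((p ℕ.∸ 1) / 2) ≤ length c)
proposition6p9 p p-prime p≢2 two-generates with odd-prime p-prime p≢2
... | k , refl = repeat k B₁ , (3≤length , quiddity , irreducible) , ℕₚ.≤-reflexive length≡
  where
  open TwoIsPrimitiveRoot k p-prime two-generates
  length≡ : 3 ℕ.* (2 ℕ.* k / 2) ≡ length (repeat k B₁)
  length≡ = trans (cong (3 ℕ.*_) (trans (cong (_/ 2) (ℕₚ.*-comm 2 k)) (m*n/n≡m k 2)))
                  (trans (ℕₚ.*-comm 3 k) (sym (length-repeat k B₁)))
  3≤length : 3 ≤ length (repeat k B₁)
  3≤length = subst (3 ≤_) (sym (length-repeat k B₁)) (ℕₚ.*-monoˡ-≤ 3 1≤k)
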